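{- Let $F$ be a forest with $n$ vertices, $c$ connected components and no isolated vertices. Then $$\max\Big\{\frac n2,\ |\mathit{Deg}_1(F)|-c\Big\}\le\beta(F)\le\frac12\big(n+|\mathit{Deg}_1(F)|\big).$$
   Context: $\beta(F)$ is the independence number (size of a maximum independent set) of $F$. $\mathit{Deg}_1(F)$ is the set of leaves of $F$, i.e., vertices of degree exactly $1$. -}

module Defs where

open import Data.Nat using (ℕ; _≤_; _≡ᵇ_)
open import Data.Bool using (Bool; true; false)
open import Data.Fin using (Fin)
open import Data.Fin.Subset using (Subset; _∈_; ∣_∣)
open import Data.Vec using (tabulate)
open import Data.List using (List; []; _∷_; _++_; [_]; length)
open import Data.List.Relation.Unary.Unique.Propositional using (Unique)
open import Data.List.Relation.Unary.Linked using (Linked)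
open import Data.Product using (Σ; _×_; ∃)
open import Function using (Surjective)
open import Function.Bundles using (_⇔_)
open import Relation.Binary.PropositionalEquality using (_≡_)
open import Relation.Nullary using (¬_)
open import Data.Empty using (⊥)

record Graph (n : ℕ) : Set where
  field
    adj    : Fin n → Fin n → Bool
    sym    : ∀ u v → adj u v ≡ adj v u
    irrefl : ∀ v → adj v v ≡ false
open Graph public

Edge : ∀ {n} → Graph n → Fin n → Fin n → Set
Edge G u v = adj G u v ≡ true

data Walk {n : ℕ} (G : Graph n) : Fin n → Fin n → Set where
  nil  : ∀ v → Walk G v v
  cons : ∀ {u v w} → Edge G u v → Walk G v w → Walk G u w

IsCycle : ∀ {n} → Graph n → List (Fin n) → Set
IsCycle G []       = ⊥
IsCycle G (v ∷ vs) = (3 ≤ length (v ∷ vs)) × Unique (v ∷ vs)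
                     × Linked (Edge G) ((v ∷ vs) ++ [ v ])

IsForest : ∀ {n} → Graph n → Set
IsForest G = ∀ xs → ¬ IsCycle G xs

degree : ∀ {n} → Graph n → Fin n → ℕ
degree G v = ∣ tabulate (adj G v) ∣

Deg₁ : ∀ {n} → Graph n → Subset n
Deg₁ G = tabulate (λ v → degree G v ≡ᵇ 1)

NoIsolated : ∀ {n} → Graph n → Set
NoIsolated G = ∀ v → 1 ≤ degree G v

HasComponents : ∀ {n} → Graph n → ℕ → Set
HasComponents {n} G c =
  Σ (Fin n → Fin c) λ comp →
    Surjective _≡_ _≡_ comp × (∀ u v → (comp u ≡ comp v) ⇔ Walk G u v)

Independent : ∀ {n} → Graph n → Subset n → Set
Independent G S = ∀ u v → u ∈ S → v ∈ S → adj G u v ≡ false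

IsIndependenceNumber : ∀ {n} → Graph n → ℕ → Set
IsIndependenceNumber G b =
  (∃ λ S → Independent G S × ∣ S ∣ ≡ b) ×
  (∀ S → Independent G S → ∣ S ∣ ≤ b)

-- A forest is bipartite: peeling off pendant edges one at a time, the pendant vertex can always
-- be recoloured opposite to its neighbour. Both colour classes are independent, so n ≤ 2β.
-- Peeling also shows that the degree sum of a forest is at most 2n. For a maximum independent
-- set S every edge at S leaves S, so double counting bounds the number of such edges by half the
-- degree sum, hence by n; as every vertex of S has degree at least 1 and all but the leaves have
-- degree at least 2, this gives 2β ≤ n + |Deg₁|. Finally, two adjacent leaves form a K₂ component;
-- dropping one end of each of the at most c such components leaves an independent set of leaves,
-- so |Deg₁| ≤ β + c.
module Submission where

open import Defs hiding (sym)
open import Data.Nat using (ℕ; _≤_; _+_; _*_)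
open import Data.Fin.Subset using (∣_∣)
open import Data.Product using (_×_)

open import Data.Bool as Bool using (Bool; true; false; _∧_; not; if_then_else_)
open import Data.Bool.Properties using (∧-comm; ∧-identityʳ; ∧-zeroʳ; ¬-not; not-¬; not-injective; T-≡)
open import Data.Empty using (⊥)
open import Data.Fin using (Fin; zero; suc; toℕ)
open import Data.Fin.Properties using (_≟_; injective⇒≤; suc-injective; any?; toℕ-injective)
open import Data.Fin.Subset using (Subset; _∈_)
open import Data.List as List using (List; []; _∷_; _++_; [_]; length)
import Data.List.Membership.DecPropositional as DecMembership
open import Data.List.Membership.Propositional using () renaming (_∈_ to _∈ˡ_)
open import Data.List.Membership.Propositional.Properties using (∈-lookup; ∈-∃++)
open import Data.List.Properties using (length-++; ++-assoc)
import Data.List.Relation.Unary.All as All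
open import Data.List.Relation.Unary.All using ([]; _∷_)
open import Data.List.Relation.Unary.All.Properties using (¬Any⇒All¬; ++⁻ˡ)
open import Data.List.Relation.Unary.AllPairs using ([]; _∷_)
open import Data.List.Relation.Unary.Any using (here; there)
open import Data.List.Relation.Unary.Linked as Linked using (Linked; []; [-]; _∷_)
open import Data.List.Relation.Unary.Unique.Propositional using (Unique)
open import Data.Nat using (zero; suc; _<_; z≤n; s≤s; _≡ᵇ_; _<?_)
open import Data.Nat.Induction using (<-wellFounded)
open import Data.Nat.Properties
  using ( +-0-commutativeMonoid; +-comm; +-assoc; +-suc; +-identityʳ; +-cancelˡ-≡
        ; ≤-refl; ≤-reflexive; ≤-trans; <⇒≱; <-cmp; <-asym; m≤m+n; m≤n+m; m<n+m
        ; +-mono-≤; +-monoˡ-≤; +-monoʳ-≤; +-mono-<-≤; +-mono-≤-<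
        ; *-distribˡ-+; *-monoʳ-≤; *-cancelˡ-≤; ≡ᵇ⇒≡; module ≤-Reasoning)
open import Data.Product using (Σ; ∃; ∃₂; _,_; proj₂)
open import Data.Sum using (_⊎_; inj₁; inj₂)
open import Data.Vec using (tabulate; lookup)
open import Data.Vec.Properties using (lookup∘tabulate; tabulate∘lookup; []=⇒lookup; lookup⇒[]=)
open import Function using (_∘_; Injective)
open import Function.Bundles using (Equivalence)
open import Induction.WellFounded using (Acc; acc)
open import Relation.Binary.Definitions using (tri<; tri≈; tri>)
open import Relation.Binary.PropositionalEquality
  using (_≡_; _≢_; ≢-sym; refl; sym; trans; cong; cong₂; subst; subst₂; module ≡-Reasoning)
open import Relation.Nullary using (Dec; yes; no; does; ¬_; contradiction)
open import Relation.Nullary.Decidable using (dec-true; dec-false; _×-dec_; ¬?; decidable-stable)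

open import Algebra.Properties.CommutativeMonoid.Sum +-0-commutativeMonoid
  using (sum; ∑-distrib-+; ∑-comm; sum-cong-≗; sum-replicate-zero)

witness : ∀ {A : Set} (a? : Dec A) → does a? ≡ true → A
witness (yes a) _ = a

∧≡true⇒ : ∀ {a b} → a ∧ b ≡ true → a ≡ true × b ≡ true
∧≡true⇒ {true} {true} _ = refl , refl

double : ∀ m → 2 * m ≡ m + m
double m = cong (m +_) (+-identityʳ m)

indicator : Bool → ℕ
indicator b = if b then 1 else 0

count : ∀ {n} → (Fin n → Bool) → ℕ
count p = sum (indicator ∘ p)

sum-mono-≤ : ∀ {n} {f g : Fin n → ℕ} → (∀ i → f i ≤ g i) → sum f ≤ sum g
sum-mono-≤ {zero}  f≤g = z≤n
sum-mono-≤ {suc n} f≤g = +-mono-≤ (f≤g zero) (sum-mono-≤ (f≤g ∘ suc))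

sum-mono-< : ∀ {n} {f g : Fin n → ℕ} → (∀ i → f i ≤ g i) → ∀ i → f i < g i → sum f < sum g
sum-mono-< f≤g zero    f<g = +-mono-<-≤ f<g (sum-mono-≤ (f≤g ∘ suc))
sum-mono-< f≤g (suc i) f<g = +-mono-≤-< (f≤g zero) (sum-mono-< (f≤g ∘ suc) i f<g)

sum-at : ∀ {n} (x : Fin n) c → sum (λ u → if does (u ≟ x) then c else 0) ≡ c
sum-at {suc n} zero c = trans (cong (c +_) (sum-replicate-zero n)) (+-identityʳ c)
sum-at (suc x) c = sum-at x c

count-none : ∀ {n} (p : Fin n → Bool) → (∀ i → p i ≡ false) → count p ≡ 0
count-none {n} p none = trans (sum-cong-≗ (cong indicator ∘ none)) (sum-replicate-zero n)

count-mono : ∀ {n} {p q : Fin n → Bool} → (∀ i → p i ≡ true → q i ≡ true) → count p ≤ count q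
count-mono {p = p} {q} p⊆q = sum-mono-≤ pointwise
  where
  pointwise : ∀ i → indicator (p i) ≤ indicator (q i)
  pointwise i with p i in pᵢ
  ... | false = z≤n
  ... | true  rewrite p⊆q i pᵢ = ≤-refl

indicator≤count : ∀ {n} (p : Fin n → Bool) i → indicator (p i) ≤ count p
indicator≤count p zero    = m≤m+n _ _
indicator≤count p (suc i) = ≤-trans (indicator≤count (p ∘ suc) i) (m≤n+m _ _)

count-split : ∀ {n} (p q : Fin n → Bool) →
              count p ≡ count (λ i → p i ∧ q i) + count (λ i → p i ∧ not (q i))
count-split p q = trans (sum-cong-≗ pointwise)
                        (∑-distrib-+ (λ i → indicator (p i ∧ q i)) (λ i → indicator (p i ∧ not (q i))))
  where
  pointwise : ∀ i → indicator (p i) ≡ indicator (p i ∧ q i) + indicator (p i ∧ not (q i))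
  pointwise i with p i | q i
  ... | false | _     = refl
  ... | true  | true  = refl
  ... | true  | false = refl

count-∧-≟ : ∀ {n} (p : Fin n → Bool) x → count (λ i → p i ∧ does (i ≟ x)) ≡ indicator (p x)
count-∧-≟ p x = trans (sum-cong-≗ pointwise) (sum-at x (indicator (p x)))
  where
  pointwise : ∀ i → indicator (p i ∧ does (i ≟ x)) ≡ (if does (i ≟ x) then indicator (p x) else 0)
  pointwise i with i ≟ x
  ... | yes refl = cong indicator (∧-identityʳ (p i))
  ... | no  _    = cong indicator (∧-zeroʳ (p i))

count+count-not : ∀ {n} (p : Fin n → Bool) → count p + count (not ∘ p) ≡ n
count+count-not {zero}  p = refl
count+count-not {suc n} p with p zero
... | true  = cong suc (count+count-not (p ∘ suc))
... | false = trans (+-suc (count (p ∘ suc)) _) (cong suc (count+count-not (p ∘ suc)))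

count≤n : ∀ {n} (p : Fin n → Bool) → count p ≤ n
count≤n p = subst (count p ≤_) (count+count-not p) (m≤m+n _ _)

count≡1⇒unique : ∀ {n} (p : Fin n → Bool) → count p ≡ 1 →
                 ∀ {a b} → p a ≡ true → p b ≡ true → a ≡ b
count≡1⇒unique p count≡1 {a} {b} pa pb with b ≟ a
... | yes b≡a = sym b≡a
... | no  b≢a = contradiction (≤-trans 1≤rest (≤-reflexive rest≡0)) λ ()
  where
  rest : Fin _ → Bool
  rest i = p i ∧ not (does (i ≟ a))
  rest≡0 : count rest ≡ 0
  rest≡0 = +-cancelˡ-≡ 1 _ _ (begin
    1 + count rest                                   ≡⟨ cong (_+ count rest) (cong indicator pa) ⟨
    indicator (p a) + count rest                     ≡⟨ cong (_+ count rest) (count-∧-≟ p a) ⟨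
    count (λ i → p i ∧ does (i ≟ a)) + count rest    ≡⟨ count-split p (λ i → does (i ≟ a)) ⟨
    count p                                          ≡⟨ count≡1 ⟩
    1                                                ∎)
    where open ≡-Reasoning
  1≤rest : 1 ≤ count rest
  1≤rest = subst (λ bit → indicator bit ≤ count rest)
                 (cong₂ (λ x y → x ∧ not y) pb (dec-false (b ≟ a) b≢a))
                 (indicator≤count rest b)

∣tabulate∣≡count : ∀ {n} (p : Fin n → Bool) → ∣ tabulate p ∣ ≡ count p
∣tabulate∣≡count {zero}  p = refl
∣tabulate∣≡count {suc n} p with p zero
... | true  = cong suc (∣tabulate∣≡count (p ∘ suc))
... | false = ∣tabulate∣≡count (p ∘ suc)

enumerate : ∀ {n} (p : Fin n → Bool) →
            Σ (Fin (count p) → Fin n) λ e → (∀ i → p (e i) ≡ true) × Injective _≡_ _≡_ e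
enumerate {zero}  p = (λ ()) , (λ ()) , λ {}
enumerate {suc n} p with p zero in p₀ | enumerate (p ∘ suc)
... | false | e , e-sound , e-inj = suc ∘ e , e-sound , e-inj ∘ suc-injective
... | true  | e , e-sound , e-inj = e′ , e′-sound , e′-inj
  where
  e′ : Fin (suc (count (p ∘ suc))) → Fin (suc n)
  e′ zero    = zero
  e′ (suc i) = suc (e i)
  e′-sound : ∀ i → p (e′ i) ≡ true
  e′-sound zero    = p₀
  e′-sound (suc i) = e-sound i
  e′-inj : Injective _≡_ _≡_ e′
  e′-inj {zero}  {zero}  _  = refl
  e′-inj {suc i} {suc j} eq = cong suc (e-inj (suc-injective eq))

count≤-injectiveOn : ∀ {n m} (p : Fin n → Bool) (h : Fin n → Fin m) →
                     (∀ {i j} → p i ≡ true → p j ≡ true → h i ≡ h j → i ≡ j) → count p ≤ m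
count≤-injectiveOn p h h-inj with enumerate p
... | e , e-sound , e-inj = injective⇒≤ (λ {i} {j} eq → e-inj (h-inj (e-sound i) (e-sound j) eq))

degree≡count : ∀ {n} (G : Graph n) u → degree G u ≡ count (adj G u)
degree≡count G u = ∣tabulate∣≡count (adj G u)

degreeSum : ∀ {n} → Graph n → ℕ
degreeSum G = sum (degree G)

Edge⇒≢ : ∀ {n} (G : Graph n) {u v} → Edge G u v → u ≢ v
Edge⇒≢ G {u} e refl = contradiction (trans (sym e) (irrefl G u)) λ ()

Edge-sym : ∀ {n} (G : Graph n) {u v} → Edge G u v → Edge G v u
Edge-sym G {u} {v} e = trans (Graph.sym G v u) e

isolate : ∀ {n} → Graph n → Fin n → Graph n
adj       (isolate G x) u v = adj G u v ∧ not (does (u ≟ x)) ∧ not (does (v ≟ x))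
Graph.sym (isolate G x) u v rewrite Graph.sym G u v =
  cong (adj G v u ∧_) (∧-comm (not (does (u ≟ x))) (not (does (v ≟ x))))
irrefl    (isolate G x) v   rewrite irrefl G v = refl

isolate-⊆ : ∀ {n} (G : Graph n) x {u v} → Edge (isolate G x) u v → Edge G u v
isolate-⊆ G x {u} {v} e with adj G u v
... | true  = refl
... | false = e

isolate-⊇ : ∀ {n} (G : Graph n) {x u v} → u ≢ x → v ≢ x → Edge G u v → Edge (isolate G x) u v
isolate-⊇ G {x} {u} {v} u≢x v≢x e
  rewrite dec-false (u ≟ x) u≢x | dec-false (v ≟ x) v≢x | e = refl

degree-isolate-≤ : ∀ {n} (G : Graph n) x u → degree (isolate G x) u ≤ degree G u
degree-isolate-≤ G x u rewrite degree≡count (isolate G x) u | degree≡count G u =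
  count-mono {p = adj (isolate G x) u} {q = adj G u} (λ v → isolate-⊆ G x)

isolate-row : ∀ {n} (G : Graph n) x v → adj (isolate G x) x v ≡ false
isolate-row G x v rewrite dec-true (x ≟ x) refl = ∧-zeroʳ (adj G x v)

isolate-avoids : ∀ {n} (G : Graph n) {x u v} → Edge (isolate G x) u v → u ≢ x
isolate-avoids G {x} {v = v} e refl = contradiction (trans (sym e) (isolate-row G x v)) λ ()

degree-isolate-self : ∀ {n} (G : Graph n) x → degree (isolate G x) x ≡ 0
degree-isolate-self G x =
  trans (degree≡count (isolate G x) x) (count-none (adj (isolate G x) x) (isolate-row G x))

degree-isolate : ∀ {n} (G : Graph n) x u →
                 degree G u ≡ degree (isolate G x) u + indicator (adj G x u)
                              + (if does (u ≟ x) then degree G x else 0)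
-- Splitting with `with u ≟ x` would also abstract u ≟ x inside the unfolded `isolate G x`.
degree-isolate G x u = by-cases (u ≟ x)
  where
  open ≡-Reasoning
  awayFromX : Fin _ → Bool
  awayFromX v = adj G u v ∧ not (does (v ≟ x))
  by-cases : (u≟x : Dec (u ≡ x)) → degree G u ≡ degree (isolate G x) u + indicator (adj G x u)
                                                  + (if does u≟x then degree G x else 0)
  by-cases (yes refl) = sym (cong₂ (λ d b → d + indicator b + degree G u)
                                   (degree-isolate-self G u) (irrefl G u))
  by-cases (no u≢x) = begin
    degree G u                                                ≡⟨ degree≡count G u ⟩
    count (adj G u)                                           ≡⟨ count-split (adj G u) (λ v → does (v ≟ x)) ⟩
    count (λ v → adj G u v ∧ does (v ≟ x)) + count awayFromX  ≡⟨ cong (_+ count awayFromX) (count-∧-≟ (adj G u) x) ⟩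
    indicator (adj G u x) + count awayFromX                   ≡⟨ +-comm _ (count awayFromX) ⟩
    count awayFromX + indicator (adj G u x)                   ≡⟨ cong₂ _+_ isolated-row (cong indicator (Graph.sym G u x)) ⟩
    degree (isolate G x) u + indicator (adj G x u)            ≡⟨ +-identityʳ _ ⟨
    degree (isolate G x) u + indicator (adj G x u) + 0        ∎
    where
    isolated-row : count awayFromX ≡ degree (isolate G x) u
    isolated-row = sym (trans (degree≡count (isolate G x) u) (sum-cong-≗ λ v →
      cong (λ b → indicator (adj G u v ∧ not b ∧ not (does (v ≟ x)))) (dec-false (u ≟ x) u≢x)))

degreeSum-isolate : ∀ {n} (G : Graph n) x → degreeSum G ≡ degreeSum (isolate G x) + 2 * degree G x
degreeSum-isolate G x = begin
  degreeSum G                                                ≡⟨ sum-cong-≗ (degree-isolate G x) ⟩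
  sum (λ u → degree G′ u + indicator (adj G x u) + atX u)    ≡⟨ ∑-distrib-+ _ atX ⟩
  sum (λ u → degree G′ u + indicator (adj G x u)) + sum atX  ≡⟨ cong (_+ sum atX) (∑-distrib-+ (degree G′) _) ⟩
  degreeSum G′ + count (adj G x) + sum atX                   ≡⟨ cong (λ d → degreeSum G′ + d + sum atX) (degree≡count G x) ⟨
  degreeSum G′ + degree G x + sum atX                        ≡⟨ cong (degreeSum G′ + degree G x +_) (sum-at x (degree G x)) ⟩
  degreeSum G′ + degree G x + degree G x                     ≡⟨ +-assoc (degreeSum G′) _ _ ⟩
  degreeSum G′ + (degree G x + degree G x)                   ≡⟨ cong (degreeSum G′ +_) (double (degree G x)) ⟨
  degreeSum G′ + 2 * degree G x                              ∎
  where
  open ≡-Reasoning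
  G′ = isolate G x
  atX : Fin _ → ℕ
  atX u = if does (u ≟ x) then degree G x else 0

Pendant : ∀ {n} → Graph n → Fin n → Fin n → Set
Pendant G x y = ∀ v → adj G x v ≡ does (v ≟ y)

module _ {n} (G : Graph n) {x y : Fin n} (pendant : Pendant G x y) where

  pendant-edge : Edge G x y
  pendant-edge = trans (pendant y) (dec-true (y ≟ y) refl)

  pendant-neighbour : ∀ {v} → Edge G x v → v ≡ y
  pendant-neighbour {v} e = witness (v ≟ y) (trans (sym (pendant v)) e)

  pendant-degree : degree G x ≡ 1
  pendant-degree = trans (degree≡count G x) (trans (sum-cong-≗ (cong indicator ∘ pendant)) (sum-at y 1))

  pendant-edge-cases : ∀ {u v} → Edge G u v →
                       (u ≡ x × v ≡ y) ⊎ (u ≡ y × v ≡ x) ⊎ Edge (isolate G x) u v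
  pendant-edge-cases {u} {v} e = cases (u ≟ x) (v ≟ x)
    where
    cases : Dec (u ≡ x) → Dec (v ≡ x) → (u ≡ x × v ≡ y) ⊎ (u ≡ y × v ≡ x) ⊎ Edge (isolate G x) u v
    cases (yes refl) _          = inj₁ (refl , pendant-neighbour e)
    cases (no _)     (yes refl) = inj₂ (inj₁ (pendant-neighbour (Edge-sym G e) , refl))
    cases (no u≢x)   (no v≢x)   = inj₂ (inj₂ (isolate-⊇ G u≢x v≢x e))

sole-neighbour⇒pendant : ∀ {n} (G : Graph n) {x y} →
                         Edge G x y → (∀ z → Edge G x z → z ≡ y) → Pendant G x y
sole-neighbour⇒pendant G {x} {y} e sole v with v ≟ y
... | yes refl = e
... | no  v≢y with adj G x v in e′
...   | true  = contradiction (sole v e′) v≢y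
...   | false = refl

module _ {A : Set} where

  Unique-++⁻ˡ : ∀ (xs : List A) {ys} → Unique (xs ++ ys) → Unique xs
  Unique-++⁻ˡ []       _           = []
  Unique-++⁻ˡ (x ∷ xs) (x∉ ∷ uniq) = ++⁻ˡ xs x∉ ∷ Unique-++⁻ˡ xs uniq

  Unique⇒lookup-injective : ∀ {xs : List A} → Unique xs → Injective _≡_ _≡_ (List.lookup xs)
  Unique⇒lookup-injective (x∉ ∷ uniq) {zero}  {zero}  eq = refl
  Unique⇒lookup-injective (x∉ ∷ uniq) {zero}  {suc j} eq = contradiction eq (All.lookup x∉ (∈-lookup j))
  Unique⇒lookup-injective (x∉ ∷ uniq) {suc i} {zero}  eq = contradiction (sym eq) (All.lookup x∉ (∈-lookup i))
  Unique⇒lookup-injective (x∉ ∷ uniq) {suc i} {suc j} eq = cong suc (Unique⇒lookup-injective uniq eq)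

  Linked-closeAt : ∀ {R : A → A → Set} {w z x} ys {zs} →
                   Linked R (w ∷ ys ++ z ∷ zs) → R z x → Linked R (w ∷ (ys ++ [ z ]) ++ [ x ])
  Linked-closeAt []       (r ∷ _)      rzx = r ∷ rzx ∷ [-]
  Linked-closeAt (y ∷ ys) (r ∷ linked) rzx = r ∷ Linked-closeAt ys linked rzx

Unique⇒length≤ : ∀ {n} {xs : List (Fin n)} → Unique xs → length xs ≤ n
Unique⇒length≤ uniq = injective⇒≤ (Unique⇒lookup-injective uniq)

isolate-forest : ∀ {n} {G : Graph n} x → IsForest G → IsForest (isolate G x)
isolate-forest x forest []       ()
isolate-forest {G = G} x forest (v ∷ vs) (long , uniq , linked) =
  forest (v ∷ vs) (long , uniq , Linked.map (isolate-⊆ G x) linked)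

module _ {n} {G : Graph n} (forest : IsForest G) where

  open DecMembership (_≟_ {n}) using (_∈?_)

  no-chord : ∀ {x y rest z} → Unique (x ∷ y ∷ rest) → Linked (Edge G) (x ∷ y ∷ rest) →
             z ∈ˡ rest → ¬ Edge G x z
  no-chord {x} {y} {z = z} uniq linked z∈rest e with ∈-∃++ z∈rest
  ... | as , bs , refl =
    forest (x ∷ y ∷ as ++ [ z ]) (long , cycle-unique , Linked-closeAt (y ∷ as) linked (Edge-sym G e))
    where
    long : 3 ≤ length (x ∷ y ∷ as ++ [ z ])
    long = s≤s (s≤s (subst (1 ≤_) (sym (length-++ as)) (m≤n+m 1 (length as))))
    cycle-unique : Unique (x ∷ y ∷ as ++ [ z ])
    cycle-unique = Unique-++⁻ˡ (x ∷ y ∷ as ++ [ z ])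
                     (subst (λ l → Unique (x ∷ y ∷ l)) (sym (++-assoc as [ z ] bs)) uniq)

  -- Grow a path at its head x until x has no neighbour besides y: a neighbour further down the
  -- path would close a cycle, and a path has at most n vertices, so k steps of fuel suffice.
  extend-path : ∀ k {x y rest} → Unique (x ∷ y ∷ rest) → Linked (Edge G) (x ∷ y ∷ rest) →
                n < length (x ∷ y ∷ rest) + k → ∃₂ (Pendant G)
  extend-path zero uniq linked n< =
    contradiction (Unique⇒length≤ uniq) (<⇒≱ (subst (n <_) (+-identityʳ _) n<))
  extend-path (suc k) {x} {y} {rest} uniq linked n<
    with any? (λ z → (adj G x z Bool.≟ true) ×-dec ¬? (z ≟ y))
  ... | no none = x , y , sole-neighbour⇒pendant G (Linked.head linked)
                            (λ z e → decidable-stable (z ≟ y) (λ z≢y → none (z , e , z≢y)))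
  ... | yes (z , e , z≢y) with z ∈? (x ∷ y ∷ rest)
  ...   | yes (here z≡x)             = contradiction (sym z≡x) (Edge⇒≢ G e)
  ...   | yes (there (here z≡y))     = contradiction z≡y z≢y
  ...   | yes (there (there z∈rest)) = contradiction e (no-chord uniq linked z∈rest)
  ...   | no z∉path = extend-path k (¬Any⇒All¬ _ z∉path ∷ uniq) (Edge-sym G e ∷ linked)
                        (subst (n <_) (+-suc _ k) n<)

  forest⇒pendant : ∀ {u v} → Edge G u v → ∃₂ (Pendant G)
  forest⇒pendant e = extend-path n ((Edge⇒≢ G e ∷ []) ∷ [] ∷ []) (e ∷ [-]) (m<n+m n (s≤s z≤n))

Edgeless : ∀ {n} → Graph n → Set
Edgeless G = ∀ u v → adj G u v ≡ false

pendant-degreeSum : ∀ {n} (G : Graph n) {x y} → Pendant G x y → degreeSum G ≡ 2 + degreeSum (isolate G x)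
pendant-degreeSum G {x} pendant = begin
  degreeSum G                                 ≡⟨ degreeSum-isolate G x ⟩
  degreeSum (isolate G x) + 2 * degree G x    ≡⟨ cong (λ d → degreeSum (isolate G x) + 2 * d)
                                                     (pendant-degree G pendant) ⟩
  degreeSum (isolate G x) + 2                 ≡⟨ +-comm _ 2 ⟩
  2 + degreeSum (isolate G x)                 ∎
  where open ≡-Reasoning

forest-induction : ∀ {n} (P : Graph n → Set) →
                   (∀ G → Edgeless G → P G) →
                   (∀ G x y → Pendant G x y → P (isolate G x) → P G) →
                   ∀ G → IsForest G → P G
forest-induction P edgeless pendant G forest = go G forest (<-wellFounded (degreeSum G))
  where
  go : ∀ G → IsForest G → Acc _<_ (degreeSum G) → P G
  go G forest (acc smaller) with any? (λ u → any? (λ v → adj G u v Bool.≟ true))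
  ... | no none = edgeless G (λ u v → ¬-not (λ e → none (u , v , e)))
  ... | yes (_ , _ , e) with forest⇒pendant forest e
  ...   | x , y , x-pendant = pendant G x y x-pendant
          (go (isolate G x) (isolate-forest x forest)
              (smaller (subst (degreeSum (isolate G x) <_) (sym (pendant-degreeSum G x-pendant))
                              (m<n+m _ (s≤s z≤n)))))

ProperColouring : ∀ {n} → Graph n → (Fin n → Bool) → Set
ProperColouring G colour = ∀ {u v} → Edge G u v → colour u ≢ colour v

forest-colourable : ∀ {n} (G : Graph n) → IsForest G → Σ (Fin n → Bool) (ProperColouring G)
forest-colourable = forest-induction (λ G → Σ _ (ProperColouring G)) monochrome recolour
  where
  monochrome : ∀ G → Edgeless G → Σ _ (ProperColouring G)
  monochrome G none = (λ _ → false) , λ {u} {v} e → contradiction (trans (sym e) (none u v)) λ ()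

  recolour : ∀ G x y → Pendant G x y → Σ _ (ProperColouring (isolate G x)) → Σ _ (ProperColouring G)
  recolour G x y pendant (colour , proper) = colour′ , proper′
    where
    colour′ : Fin _ → Bool
    colour′ u = if does (u ≟ x) then not (colour y) else colour u
    at-x : colour′ x ≡ not (colour y)
    at-x = cong (λ b → if b then not (colour y) else colour x) (dec-true (x ≟ x) refl)
    off-x : ∀ {u} → u ≢ x → colour′ u ≡ colour u
    off-x {u} u≢x = cong (λ b → if b then not (colour y) else colour u) (dec-false (u ≟ x) u≢x)
    y≢x : y ≢ x
    y≢x = ≢-sym (Edge⇒≢ G (pendant-edge G pendant))
    pendant-ends : colour′ x ≢ colour′ y
    pendant-ends same = not-¬ refl (sym (trans (sym at-x) (trans same (off-x y≢x))))
    proper′ : ProperColouring G colour′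
    proper′ e with pendant-edge-cases G pendant e
    ... | inj₁ (refl , refl)      = pendant-ends
    ... | inj₂ (inj₁ (refl , refl)) = pendant-ends ∘ sym
    ... | inj₂ (inj₂ e′) = λ same → proper e′ (trans (sym (off-x (isolate-avoids G e′)))
                             (trans same (off-x (isolate-avoids G (Edge-sym (isolate G x) e′)))))

nonIsolated : ∀ {n} → Graph n → Fin n → Bool
nonIsolated G u = not (degree G u ≡ᵇ 0)

nonzero-mono : ∀ {m n} → m ≤ n → indicator (not (m ≡ᵇ 0)) ≤ indicator (not (n ≡ᵇ 0))
nonzero-mono {zero}          _ = z≤n
nonzero-mono {suc m} {suc n} _ = ≤-refl

forest-degreeSum≤ : ∀ {n} (G : Graph n) → IsForest G → degreeSum G ≤ 2 * count (nonIsolated G)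
forest-degreeSum≤ {n} =
  forest-induction (λ G → degreeSum G ≤ 2 * count (nonIsolated G)) no-degree remove-pendant
  where
  no-degree : ∀ G → Edgeless G → degreeSum G ≤ 2 * count (nonIsolated G)
  no-degree G none = subst (_≤ 2 * count (nonIsolated G)) (sym degreeSum≡0) z≤n
    where
    degreeSum≡0 : degreeSum G ≡ 0
    degreeSum≡0 = trans (sum-cong-≗ λ u → trans (degree≡count G u) (count-none (adj G u) (none u)))
                        (sum-replicate-zero n)

  remove-pendant : ∀ G x y → Pendant G x y →
                   degreeSum (isolate G x) ≤ 2 * count (nonIsolated (isolate G x)) →
                   degreeSum G ≤ 2 * count (nonIsolated G)
  remove-pendant G x y pendant ih = begin
    degreeSum G                                         ≡⟨ pendant-degreeSum G pendant ⟩
    2 + degreeSum (isolate G x)                         ≤⟨ +-monoʳ-≤ 2 ih ⟩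
    2 + 2 * count (nonIsolated (isolate G x))           ≡⟨ *-distribˡ-+ 2 1 _ ⟨
    2 * suc (count (nonIsolated (isolate G x)))         ≤⟨ *-monoʳ-≤ 2 fewer ⟩
    2 * count (nonIsolated G)                           ∎
    where
    open ≤-Reasoning
    fewer : count (nonIsolated (isolate G x)) < count (nonIsolated G)
    fewer = sum-mono-< (λ u → nonzero-mono (degree-isolate-≤ G x u)) x
              (subst₂ (λ d d′ → indicator (not (d′ ≡ᵇ 0)) < indicator (not (d ≡ᵇ 0)))
                      (sym (pendant-degree G pendant)) (sym (degree-isolate-self G x)) ≤-refl)

forest-degreeSum≤2n : ∀ {n} (G : Graph n) → IsForest G → degreeSum G ≤ 2 * n
forest-degreeSum≤2n G forest =
  ≤-trans (forest-degreeSum≤ G forest) (*-monoʳ-≤ 2 (count≤n (nonIsolated G)))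

Independentᵇ : ∀ {n} → Graph n → (Fin n → Bool) → Set
Independentᵇ G p = ∀ {u v} → Edge G u v → p u ≡ true → p v ≡ true → ⊥

independentᵇ⇒independent : ∀ {n} (G : Graph n) {p} → Independentᵇ G p → Independent G (tabulate p)
independentᵇ⇒independent G {p} independent u v u∈ v∈ with adj G u v in e
... | true  = contradiction (∈-tabulate v∈) (independent e (∈-tabulate u∈))
  where
  ∈-tabulate : ∀ {w} → w ∈ tabulate p → p w ≡ true
  ∈-tabulate {w} w∈ = trans (sym (lookup∘tabulate p w)) ([]=⇒lookup w∈)
... | false = refl

independent⇒independentᵇ : ∀ {n} (G : Graph n) {S} → Independent G S → Independentᵇ G (lookup S)
independent⇒independentᵇ G {S} independent {u} {v} e u∈ v∈ =
  contradiction (trans (sym e) (independent u v (lookup⇒[]= u S u∈) (lookup⇒[]= v S v∈))) λ ()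

∣∣≡count-lookup : ∀ {n} (S : Subset n) → ∣ S ∣ ≡ count (lookup S)
∣∣≡count-lookup S = trans (cong ∣_∣ (sym (tabulate∘lookup S))) (∣tabulate∣≡count (lookup S))

colouring⇒n≤2β : ∀ {n β} (G : Graph n) {colour} → ProperColouring G colour →
                 IsIndependenceNumber G β → n ≤ 2 * β
colouring⇒n≤2β {n} {β} G {colour} proper (_ , maximum) = begin
  n                                      ≡⟨ count+count-not colour ⟨
  count colour + count (not ∘ colour)    ≤⟨ +-mono-≤ (class-≤β colour one-class)
                                                     (class-≤β (not ∘ colour) other-class) ⟩
  β + β                                  ≡⟨ double β ⟨
  2 * β                                  ∎
  where
  open ≤-Reasoning
  class-≤β : ∀ p → Independentᵇ G p → count p ≤ β
  class-≤β p independent =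
    subst (_≤ β) (∣tabulate∣≡count p) (maximum _ (independentᵇ⇒independent G independent))
  one-class : Independentᵇ G colour
  one-class e cu cv = proper e (trans cu (sym cv))
  other-class : Independentᵇ G (not ∘ colour)
  other-class e cu cv = proper e (not-injective (trans cu (sym cv)))

degreeOn : ∀ {n} → Graph n → (Fin n → Bool) → ℕ
degreeOn G p = sum (λ u → if p u then degree G u else 0)

degreeOn+degreeOn-not : ∀ {n} (G : Graph n) p → degreeOn G p + degreeOn G (not ∘ p) ≡ degreeSum G
degreeOn+degreeOn-not G p = trans (sym (∑-distrib-+ (λ u → if p u then degree G u else 0)
                                                    (λ u → if not (p u) then degree G u else 0)))
                                  (sum-cong-≗ pointwise)
  where
  pointwise : ∀ u → (if p u then degree G u else 0) + (if not (p u) then degree G u else 0) ≡ degree G u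
  pointwise u with p u
  ... | true  = +-identityʳ _
  ... | false = refl

degreeOn≡∑count : ∀ {n} (G : Graph n) p → degreeOn G p ≡ sum (λ u → count (λ v → p u ∧ adj G u v))
degreeOn≡∑count {n} G p = sum-cong-≗ pointwise
  where
  pointwise : ∀ u → (if p u then degree G u else 0) ≡ count (λ v → p u ∧ adj G u v)
  pointwise u with p u
  ... | true  = degree≡count G u
  ... | false = sym (count-none {n} (λ _ → false) (λ _ → refl))

-- Every edge leaving an independent set enters its complement.
independent⇒degreeOn≤ : ∀ {n} (G : Graph n) {p} → Independentᵇ G p → degreeOn G p ≤ degreeOn G (not ∘ p)
independent⇒degreeOn≤ G {p} independent = begin
  degreeOn G p                                          ≡⟨ degreeOn≡∑count G p ⟩
  sum (λ u → count (λ v → p u ∧ adj G u v))             ≤⟨ sum-mono-≤ (λ u → sum-mono-≤ (λ v → pointwise u v)) ⟩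
  sum (λ u → count (λ v → not (p v) ∧ adj G v u))       ≡⟨ ∑-comm (λ u v → indicator (not (p v) ∧ adj G v u)) ⟩
  sum (λ v → count (λ u → not (p v) ∧ adj G v u))       ≡⟨ degreeOn≡∑count G (not ∘ p) ⟨
  degreeOn G (not ∘ p)                                  ∎
  where
  open ≤-Reasoning
  pointwise : ∀ u v → indicator (p u ∧ adj G u v) ≤ indicator (not (p v) ∧ adj G v u)
  pointwise u v with p u in pᵤ | adj G u v in e
  ... | false | _     = z≤n
  ... | true  | false = z≤n
  ... | true  | true with p v in pᵥ
  ...   | true  = contradiction pᵥ (independent e pᵤ)
  ...   | false = ≤-reflexive (cong indicator (sym (Edge-sym G e)))

2*degreeOn≤degreeSum : ∀ {n} (G : Graph n) {p} → Independentᵇ G p → 2 * degreeOn G p ≤ degreeSum G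
2*degreeOn≤degreeSum G {p} independent = begin
  2 * degreeOn G p                          ≡⟨ double (degreeOn G p) ⟩
  degreeOn G p + degreeOn G p               ≤⟨ +-monoʳ-≤ (degreeOn G p) (independent⇒degreeOn≤ G independent) ⟩
  degreeOn G p + degreeOn G (not ∘ p)       ≡⟨ degreeOn+degreeOn-not G p ⟩
  degreeSum G                               ∎
  where open ≤-Reasoning

leaf : ∀ {n} → Graph n → Fin n → Bool
leaf G u = degree G u ≡ᵇ 1

-- A vertex of degree at least two pays for itself twice; a leaf needs one unit from Deg₁.
2*count≤degreeOn+leaves : ∀ {n} (G : Graph n) p → NoIsolated G →
                          2 * count p ≤ degreeOn G p + count (leaf G)
2*count≤degreeOn+leaves G p noIsolated = begin
  2 * count p                                 ≡⟨ double (count p) ⟩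
  count p + count p                           ≡⟨ ∑-distrib-+ (indicator ∘ p) (indicator ∘ p) ⟨
  sum (λ u → indicator (p u) + indicator (p u))  ≤⟨ sum-mono-≤ pointwise ⟩
  sum (λ u → (if p u then degree G u else 0) + indicator (leaf G u))
                                              ≡⟨ ∑-distrib-+ (λ u → if p u then degree G u else 0) (indicator ∘ leaf G) ⟩
  degreeOn G p + count (leaf G)               ∎
  where
  open ≤-Reasoning
  pointwise : ∀ u → indicator (p u) + indicator (p u) ≤
                    (if p u then degree G u else 0) + indicator (leaf G u)
  pointwise u with p u | degree G u | noIsolated u
  ... | false | _           | _ = z≤n
  ... | true  | suc zero    | _ = ≤-refl
  ... | true  | suc (suc d) | _ = s≤s (s≤s z≤n)

independent-2*≤n+leaves : ∀ {n} (G : Graph n) → IsForest G → NoIsolated G →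
                          ∀ {S} → Independent G S → 2 * ∣ S ∣ ≤ n + ∣ Deg₁ G ∣
independent-2*≤n+leaves {n} G forest noIsolated {S} independent = *-cancelˡ-≤ 2 (begin
  2 * (2 * ∣ S ∣)                               ≡⟨ cong (λ k → 2 * (2 * k)) (∣∣≡count-lookup S) ⟩
  2 * (2 * count s)                             ≤⟨ *-monoʳ-≤ 2 (2*count≤degreeOn+leaves G s noIsolated) ⟩
  2 * (degreeOn G s + count (leaf G))           ≡⟨ *-distribˡ-+ 2 (degreeOn G s) _ ⟩
  2 * degreeOn G s + 2 * count (leaf G)         ≤⟨ +-monoˡ-≤ _ (2*degreeOn≤degreeSum G
                                                     (independent⇒independentᵇ G independent)) ⟩
  degreeSum G + 2 * count (leaf G)              ≤⟨ +-monoˡ-≤ _ (forest-degreeSum≤2n G forest) ⟩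
  2 * n + 2 * count (leaf G)                    ≡⟨ *-distribˡ-+ 2 n _ ⟨
  2 * (n + count (leaf G))                      ≡⟨ cong (λ k → 2 * (n + k)) (∣tabulate∣≡count (leaf G)) ⟨
  2 * (n + ∣ Deg₁ G ∣)                          ∎)
  where
  open ≤-Reasoning
  s = lookup S

leaf⇒degree≡1 : ∀ {n} (G : Graph n) {u} → leaf G u ≡ true → degree G u ≡ 1
leaf⇒degree≡1 G {u} isLeaf = ≡ᵇ⇒≡ (degree G u) 1 (Equivalence.from T-≡ isLeaf)

leaf-neighbour-unique : ∀ {n} (G : Graph n) {u a b} → leaf G u ≡ true → Edge G u a → Edge G u b → a ≡ b
leaf-neighbour-unique G {u} isLeaf =
  count≡1⇒unique (adj G u) (trans (sym (degree≡count G u)) (leaf⇒degree≡1 G isLeaf))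

K₂-closed : ∀ {n} (G : Graph n) {u w} → leaf G u ≡ true → leaf G w ≡ true → Edge G u w →
            ∀ {a b} → Walk G a b → a ≡ u ⊎ a ≡ w → b ≡ u ⊎ b ≡ w
K₂-closed G uLeaf wLeaf e (nil _)         a∈ = a∈
K₂-closed G uLeaf wLeaf e (cons e′ walk) (inj₁ refl) =
  K₂-closed G uLeaf wLeaf e walk (inj₂ (leaf-neighbour-unique G uLeaf e′ e))
K₂-closed G uLeaf wLeaf e (cons e′ walk) (inj₂ refl) =
  K₂-closed G uLeaf wLeaf e walk (inj₁ (leaf-neighbour-unique G wLeaf e′ (Edge-sym G e)))

LowerK₂End : ∀ {n} → Graph n → Fin n → Set
LowerK₂End G u = leaf G u ≡ true × ∃ λ w → Edge G u w × leaf G w ≡ true × toℕ u < toℕ w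

lowerK₂End? : ∀ {n} (G : Graph n) u → Dec (LowerK₂End G u)
lowerK₂End? G u = (leaf G u Bool.≟ true) ×-dec
                  any? (λ w → (adj G u w Bool.≟ true) ×-dec (leaf G w Bool.≟ true) ×-dec (toℕ u <? toℕ w))

lowerK₂End : ∀ {n} → Graph n → Fin n → Bool
lowerK₂End G u = does (lowerK₂End? G u)

leaves-minus-lowerK₂Ends-independent : ∀ {n} (G : Graph n) →
                                       Independentᵇ G (λ u → leaf G u ∧ not (lowerK₂End G u))
leaves-minus-lowerK₂Ends-independent G {u} {v} e uIn vIn
  with ∧≡true⇒ {leaf G u} uIn | ∧≡true⇒ {leaf G v} vIn
... | uLeaf , uNotLower | vLeaf , vNotLower with <-cmp (toℕ u) (toℕ v)
...   | tri< u<v _ _ =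
  not-¬ (sym (dec-true (lowerK₂End? G u) (uLeaf , v , e , vLeaf , u<v))) (sym uNotLower)
...   | tri≈ _ u≡v _ = Edge⇒≢ G e (toℕ-injective u≡v)
...   | tri> _ _ v<u =
  not-¬ (sym (dec-true (lowerK₂End? G v) (vLeaf , u , Edge-sym G e , uLeaf , v<u))) (sym vNotLower)

lowerK₂End-component-unique : ∀ {n} (G : Graph n) {u u′} → LowerK₂End G u → LowerK₂End G u′ →
                              Walk G u u′ → u ≡ u′
lowerK₂End-component-unique G (uLeaf , w , e , wLeaf , u<w) (_ , w′ , e′ , _ , u′<w′) walk
  with K₂-closed G uLeaf wLeaf e walk (inj₁ refl)
... | inj₁ u′≡u = sym u′≡u
... | inj₂ refl = contradiction w<u (<-asym u<w)
  where
  w<u = subst (λ z → toℕ _ < toℕ z) (leaf-neighbour-unique G wLeaf e′ (Edge-sym G e)) u′<w′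

lowerK₂Ends≤components : ∀ {n c} (G : Graph n) → HasComponents G c → count (lowerK₂End G) ≤ c
lowerK₂Ends≤components G (component , _ , sameComponent⇔walk) =
  count≤-injectiveOn (lowerK₂End G) component λ {u} {u′} uLower u′Lower same →
    lowerK₂End-component-unique G (witness (lowerK₂End? G u) uLower)
                                  (witness (lowerK₂End? G u′) u′Lower)
                                  (Equivalence.to (sameComponent⇔walk u u′) same)

leaves≤β+components : ∀ {n c β} (G : Graph n) → HasComponents G c → IsIndependenceNumber G β →
                      ∣ Deg₁ G ∣ ≤ β + c
leaves≤β+components {c = c} {β} G components (_ , maximum) = begin
  ∣ Deg₁ G ∣                                                  ≡⟨ ∣tabulate∣≡count (leaf G) ⟩
  count (leaf G)                                              ≡⟨ count-split (leaf G) (lowerK₂End G) ⟩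
  count (λ u → leaf G u ∧ lowerK₂End G u) + count rest        ≤⟨ +-monoˡ-≤ _ (count-mono λ u →
                                                                   proj₂ ∘ ∧≡true⇒ {leaf G u}) ⟩
  count (lowerK₂End G) + count rest                           ≡⟨ +-comm _ (count rest) ⟩
  count rest + count (lowerK₂End G)                           ≤⟨ +-mono-≤ rest≤β (lowerK₂Ends≤components G components) ⟩
  β + c                                                       ∎
  where
  open ≤-Reasoning
  rest : Fin _ → Bool
  rest u = leaf G u ∧ not (lowerK₂End G u)
  rest≤β : count rest ≤ β
  rest≤β = subst (_≤ β) (∣tabulate∣≡count rest)
             (maximum _ (independentᵇ⇒independent G (leaves-minus-lowerK₂Ends-independent G)))

theorem10 : (n c β : ℕ) (F : Graph n) → IsForest F → NoIsolated F → HasComponents F c → IsIndependenceNumber F β → (n ≤ 2 * β) × (∣ Deg₁ F ∣ ≤ β + c) × (2 * β ≤ n + ∣ Deg₁ F ∣)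
theorem10 n c β F forest noIsolated components independenceNumber@((S , S-independent , ∣S∣≡β) , _) =
    colouring⇒n≤2β F (proj₂ (forest-colourable F forest)) independenceNumber
  , leaves≤β+components F components independenceNumber
  , subst (λ b → 2 * b ≤ n + ∣ Deg₁ F ∣) ∣S∣≡β
          (independent-2*≤n+leaves F forest noIsolated S-independent)
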